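{- Let $G$ be an equitably $k$-colorable graph on $n$ vertices and let $H$ be an $r$-partite graph with $r\le k-1$. If $k$ divides $n$, then for every integer $l\ge 1$, $\chi_{=}(G\circ^l H)\le k$.
   Context: All graphs are finite, simple and connected. A graph is $r$-partite if its vertex set can be partitioned into $r$ independent sets. A graph is equitably $k$-colorable if its vertex set can be partitioned into $k$ (possibly empty) independent sets $V_1,\dots,V_k$ with $||V_i|-|V_j||\le 1$ for all $i,j$; $\chi_{=}(G)$ is the least $k$ for which $G$ is equitably $k$-colorable. The corona $G\circ H$ is formed from one copy of $G$ and $|V(G)|$ copies of $H$, the $i$-th vertex of $G$ being joined to every vertex of the $i$-th copy of $H$; $G\circ^1 H=G\circ H$ and $G\circ^l H=(G\circ^{l-1}H)\circ H$ for $l\ge 2$. -}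

module Defs where

open import Data.Nat using (ℕ; zero; suc; _+_; _*_; _≤_)
open import Data.Fin using (Fin; splitAt; remQuot)
open import Data.Bool using (Bool; true; false; if_then_else_)
open import Data.Sum using (_⊎_; inj₁; inj₂)
open import Data.Product using (_×_; _,_; Σ; ∃)
open import Data.List using (List; []; _∷_; length; filter; allFin)
open import Relation.Binary.PropositionalEquality using (_≡_; _≢_)
open import Relation.Nullary using (¬_)
open import Data.Fin using (_≟_)
open import Relation.Nullary using (yes; no)
open import Relation.Nullary.Decidable using (⌊_⌋)
open import Data.Empty using (⊥-elim)
open import Data.Bool using (_∧_)
open import Data.Bool.Properties using (∧-zeroʳ)
import Data.Sum as Sum
open import Relation.Binary.PropositionalEquality using (refl; cong₂) renaming (sym to ≡sym)

record Graph : Set where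
  field
    size  : ℕ
    adj   : Fin size → Fin size → Bool
    sym   : ∀ u v → adj u v ≡ adj v u
    irrefl : ∀ v → adj v v ≡ false
open Graph public

Adj : (G : Graph) → Fin (size G) → Fin (size G) → Set
Adj G u v = adj G u v ≡ true

data Walk (G : Graph) : Fin (size G) → Fin (size G) → Set where
  here : ∀ {v} → Walk G v v
  step : ∀ {u w v} → Adj G u w → Walk G w v → Walk G u v

Connected : Graph → Set
Connected G = ∀ u v → Walk G u v

Proper : (G : Graph) (k : ℕ) → (Fin (size G) → Fin k) → Set
Proper G k c = ∀ u v → Adj G u v → c u ≢ c v

Partite : ℕ → Graph → Set
Partite r G = Σ (Fin (size G) → Fin r) (Proper G r)

classSize : (G : Graph) (k : ℕ) → (Fin (size G) → Fin k) → Fin k → ℕ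
classSize G k c i = length (filter (λ v → c v ≟ i) (allFin (size G)))

EquitablyColorable : ℕ → Graph → Set
EquitablyColorable k G =
  Σ (Fin (size G) → Fin k) λ c →
    Proper G k c × (∀ i j → classSize G k c i ≤ suc (classSize G k c j))

EqChromaticAtMost : Graph → ℕ → Set
EqChromaticAtMost G k = ∃ λ j → j ≤ k × EquitablyColorable j G

-- corona G ∘ H: vertices Fin (n + n * m); the first n are G's vertices,
-- and vertex n + q with remQuot q = (i , j) is vertex j of the i-th copy of H
-- (joined to vertex i of G).
same : ∀ {n} → Fin n → Fin n → Bool
same a b = ⌊ a ≟ b ⌋

same-sym : ∀ {n} (a b : Fin n) → same a b ≡ same b a
same-sym a b with a ≟ b | b ≟ a
... | yes _ | yes _ = refl
... | no _  | no _  = refl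
... | yes p | no q  = ⊥-elim (q (≡sym p))
... | no p  | yes q = ⊥-elim (p (≡sym q))

cAdj : (G H : Graph) → Fin (size G) ⊎ (Fin (size G) × Fin (size H))
     → Fin (size G) ⊎ (Fin (size G) × Fin (size H)) → Bool
cAdj G H (inj₁ u) (inj₁ v) = adj G u v
cAdj G H (inj₁ u) (inj₂ (i , _)) = same u i
cAdj G H (inj₂ (i , _)) (inj₁ v) = same i v
cAdj G H (inj₂ (i , a)) (inj₂ (i' , b)) = same i i' ∧ adj H a b

decode : (G H : Graph) → Fin (size G + size G * size H)
       → Fin (size G) ⊎ (Fin (size G) × Fin (size H))
decode G H x = Sum.map₂ (remQuot {size G} (size H)) (splitAt (size G) x)

cAdj-sym : (G H : Graph) → ∀ x y → cAdj G H x y ≡ cAdj G H y x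
cAdj-sym G H (inj₁ u) (inj₁ v) = sym G u v
cAdj-sym G H (inj₁ u) (inj₂ (i , _)) = same-sym u i
cAdj-sym G H (inj₂ (i , _)) (inj₁ v) = same-sym i v
cAdj-sym G H (inj₂ (i , a)) (inj₂ (i' , b)) = cong₂ _∧_ (same-sym i i') (sym H a b)

cAdj-irrefl : (G H : Graph) → ∀ x → cAdj G H x x ≡ false
cAdj-irrefl G H (inj₁ u) = irrefl G u
cAdj-irrefl G H (inj₂ (i , a)) rewrite irrefl H a = ∧-zeroʳ (same i i)

corona : Graph → Graph → Graph
corona G H = record
  { size = size G + size G * size H
  ; adj = λ x y → cAdj G H (decode G H x) (decode G H y)
  ; sym = λ x y → cAdj-sym G H (decode G H x) (decode G H y)
  ; irrefl = λ x → cAdj-irrefl G H (decode G H x)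
  }

-- iterated corona: G ∘¹ H = G ∘ H,  G ∘ˡ H = (G ∘ˡ⁻¹ H) ∘ H
-- (coronaIter G H l is G ∘^(l+1) H)
coronaIter : Graph → Graph → ℕ → Graph
coronaIter G H zero = corona G H
coronaIter G H (suc l) = corona (coronaIter G H l) H

corona^ : Graph → Graph → (l : ℕ) → 1 ≤ l → Graph
corona^ G H (suc l) _ = coronaIter G H l

-- Since k divides n, an equitable k-colouring c of G is uniform: every class has exactly n/k
-- vertices. Fix a proper r-colouring h of H and give vertex a of the copy of H attached to u the
-- colour c(u) + 1 + h(a) (mod k). As 1 ≤ 1 + h(a) ≤ r < k, such a vertex never shares the colour
-- of u, and adjacent vertices of one copy get different colours. For fixed a, the map
-- u ↦ c(u) + 1 + h(a) permutes the colours, so every class of G ∘ H gains exactly |H| · n/k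
-- vertices and the colouring is again uniform; iterating gives the result for every G ∘ˡ H.
module Submission where

open import Defs hiding (sym)
open import Data.Nat using (ℕ; _≤_; _+_)
open import Data.Nat.Divisibility using (_∣_)

open import Data.Bool using (true; if_then_else_)
open import Data.Bool.Properties using (T-≡; T-∧)
open import Data.Fin using (Fin; toℕ; splitAt; remQuot; quotRem)
  renaming (zero to fzero; suc to fsuc)
open import Data.Fin.Permutation
  using (Permutation′; permutation; _⟨$⟩ʳ_; _⟨$⟩ˡ_; inverseˡ; inverseʳ)
open import Data.Fin.Properties using (_≟_; toℕ-fromℕ<; toℕ-injective; toℕ<n)
open import Data.List using (length; filter; tabulate)
open import Data.Nat using (zero; suc; _*_; _∸_; _<_; z≤n; s≤s; z<s; _%_; NonZero; >-nonZero)
open import Data.Nat.Divisibility using (divides)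
open import Data.Nat.DivMod using (_mod_; %-distribˡ-+; m%n%n≡m%n; m%n<n; [m+n]%n≡m%n; m<n⇒m%n≡m)
open import Data.Nat.Properties
  using ( +-0-commutativeMonoid; +-commutativeSemigroup; +-assoc; +-comm; +-identityʳ
        ; *-identityʳ; *-comm; +-mono-≤; +-mono-<-≤; +-mono-≤-<; m∸n+n≡m; m+[n∸m]≡n
        ; <-cmp; <⇒≤; <⇒≢; ≤-refl; ≤-trans; ≤-pred; n≤1+n; suc-injective; module ≤-Reasoning)
open import Algebra.Properties.CommutativeMonoid.Sum +-0-commutativeMonoid
  using (sum-syntax; sum-cong-≗; sum-replicate-zero; ∑-comm)
open import Algebra.Properties.CommutativeSemigroup +-commutativeSemigroup using (x∙yz≈y∙xz)
open import Data.Product using (_×_; _,_; proj₁; proj₂)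
import Data.Product as Product
open import Data.Sum using (_⊎_; inj₁; inj₂)
import Data.Sum as Sum
open import Function using (_∘_; id)
open import Function.Bundles using (Equivalence)
open import Relation.Binary using (tri<; tri≈; tri>)
open import Relation.Binary.PropositionalEquality
  using (_≡_; _≢_; refl; cong; cong₂; trans; sym; subst; subst₂; module ≡-Reasoning)
open import Relation.Nullary using (Dec; does; yes; no; contradiction)
open import Relation.Nullary.Decidable using (toWitness)
open import Relation.Unary using (Pred; Decidable)

indicator : ∀ {a} {A : Set a} → Dec A → ℕ
indicator a? = if does a? then 1 else 0

∑-const : ∀ n m → ∑[ i < n ] m ≡ n * m
∑-const zero    m = refl
∑-const (suc n) m = cong (m +_) (∑-const n m)

∑-splitAt : ∀ m n (f : Fin m ⊎ Fin n → ℕ) →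
  ∑[ x < m + n ] f (splitAt m x) ≡ ∑[ i < m ] f (inj₁ i) + ∑[ j < n ] f (inj₂ j)
∑-splitAt zero    n f = refl
∑-splitAt (suc m) n f =
  trans (cong (f (inj₁ fzero) +_) (∑-splitAt m n (f ∘ Sum.map₁ fsuc)))
        (sym (+-assoc (f (inj₁ fzero)) _ _))

∑-remQuot : ∀ m n (f : Fin m × Fin n → ℕ) →
  ∑[ x < m * n ] f (remQuot n x) ≡ ∑[ i < m ] ∑[ j < n ] f (i , j)
∑-remQuot zero    n f = refl
∑-remQuot (suc m) n f =
  trans (∑-splitAt n (m * n) f∘remQuot)
        (cong (∑[ j < n ] f (fzero , j) +_) (∑-remQuot m n (f ∘ Product.map₁ fsuc)))
  where
  -- f ∘ remQuot n, with remQuot unfolded one step through splitAt n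
  f∘remQuot : Fin n ⊎ Fin (m * n) → ℕ
  f∘remQuot = f ∘ Product.swap ∘ Sum.[ (_, fzero) , Product.map₂ fsuc ∘ quotRem {m} n ]′

∑-mono-≤ : ∀ n {f g : Fin n → ℕ} → (∀ i → f i ≤ g i) → ∑[ i < n ] f i ≤ ∑[ i < n ] g i
∑-mono-≤ zero    f≤g = z≤n
∑-mono-≤ (suc n) f≤g = +-mono-≤ (f≤g fzero) (∑-mono-≤ n (f≤g ∘ fsuc))

∑-mono-< : ∀ n {f g : Fin n → ℕ} → (∀ i → f i ≤ g i) → ∀ i → f i < g i →
  ∑[ i < n ] f i < ∑[ i < n ] g i
∑-mono-< (suc n) f≤g fzero    fi<gi = +-mono-<-≤ fi<gi (∑-mono-≤ n (f≤g ∘ fsuc))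
∑-mono-< (suc n) f≤g (fsuc i) fi<gi = +-mono-≤-< (f≤g fzero) (∑-mono-< n (f≤g ∘ fsuc) i fi<gi)

length-filter-tabulate : ∀ {a p} {A : Set a} {P : Pred A p} (P? : Decidable P)
  n (f : Fin n → A) →
  length (filter P? (tabulate f)) ≡ ∑[ i < n ] indicator (P? (f i))
length-filter-tabulate P? zero    f = refl
length-filter-tabulate P? (suc n) f with P? (f fzero)
... | yes _ = cong suc (length-filter-tabulate P? n (f ∘ fsuc))
... | no _  = length-filter-tabulate P? n (f ∘ fsuc)

count : ∀ {n k} → (Fin n → Fin k) → Fin k → ℕ
count {n} c j = ∑[ v < n ] indicator (c v ≟ j)

∑-indicator-≟ : ∀ {k} (x : Fin k) → ∑[ j < k ] indicator (x ≟ j) ≡ 1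
∑-indicator-≟ {suc k} fzero    = cong suc (sum-replicate-zero k)
∑-indicator-≟ {suc k} (fsuc x) = ∑-indicator-≟ x

∑-count : ∀ {n k} (c : Fin n → Fin k) → ∑[ j < k ] count c j ≡ n
∑-count {n} {k} c = begin
  ∑[ j < k ] ∑[ v < n ] indicator (c v ≟ j) ≡⟨ ∑-comm (λ j v → indicator (c v ≟ j)) ⟩
  ∑[ v < n ] ∑[ j < k ] indicator (c v ≟ j) ≡⟨ sum-cong-≗ (∑-indicator-≟ ∘ c) ⟩
  ∑[ v < n ] 1                              ≡⟨ ∑-const n 1 ⟩
  n * 1                                     ≡⟨ *-identityʳ n ⟩
  n                                         ∎
  where open ≡-Reasoning

indicator-permute : ∀ {k} (π : Permutation′ k) x j →
  indicator (π ⟨$⟩ʳ x ≟ j) ≡ indicator (x ≟ π ⟨$⟩ˡ j)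
indicator-permute π x j with π ⟨$⟩ʳ x ≟ j | x ≟ π ⟨$⟩ˡ j
... | yes _    | yes _     = refl
... | no _     | no _      = refl
... | yes πx≡j | no x≢π⁻¹j =
  contradiction (trans (sym (inverseˡ π)) (cong (π ⟨$⟩ˡ_) πx≡j)) x≢π⁻¹j
... | no πx≢j  | yes x≡π⁻¹j =
  contradiction (trans (cong (π ⟨$⟩ʳ_) x≡π⁻¹j) (inverseʳ π)) πx≢j

count-permute : ∀ {n k} (π : Permutation′ k) (c : Fin n → Fin k) j →
  count ((π ⟨$⟩ʳ_) ∘ c) j ≡ count c (π ⟨$⟩ˡ j)
count-permute π c j = sum-cong-≗ (λ v → indicator-permute π (c v) j)

spread≤1-∑≡q*k⇒≡q : ∀ k (S : Fin k → ℕ) q → ∑[ i < k ] S i ≡ q * k →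
  (∀ i j → S i ≤ suc (S j)) → ∀ i → S i ≡ q
spread≤1-∑≡q*k⇒≡q k S q ∑S≡qk S≤1+S i with <-cmp (S i) q
... | tri≈ _ Si≡q _ = Si≡q
... | tri< Si<q _ _ = contradiction ∑S≡qk (<⇒≢ (begin-strict
  ∑[ j < k ] S j <⟨ ∑-mono-< k (λ j → ≤-trans (S≤1+S j i) Si<q) i Si<q ⟩
  ∑[ j < k ] q   ≡⟨ ∑-const k q ⟩
  k * q          ≡⟨ *-comm k q ⟩
  q * k          ∎))
  where open ≤-Reasoning
... | tri> _ _ Si>q = contradiction (sym ∑S≡qk) (<⇒≢ (begin-strict
  q * k          ≡⟨ *-comm q k ⟩
  k * q          ≡⟨ sym (∑-const k q) ⟩
  ∑[ j < k ] q   <⟨ ∑-mono-< k (λ j → ≤-pred (≤-trans Si>q (S≤1+S i j))) i Si>q ⟩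
  ∑[ j < k ] S j ∎))
  where open ≤-Reasoning

[m%n+o]%n≡[m+o]%n : ∀ m o n .{{_ : NonZero n}} → (m % n + o) % n ≡ (m + o) % n
[m%n+o]%n≡[m+o]%n m o n = begin
  (m % n + o) % n         ≡⟨ %-distribˡ-+ (m % n) o n ⟩
  (m % n % n + o % n) % n ≡⟨ cong (λ r → (r + o % n) % n) (m%n%n≡m%n m n) ⟩
  (m % n + o % n) % n     ≡⟨ %-distribˡ-+ m o n ⟨
  (m + o) % n             ∎
  where open ≡-Reasoning

module Rotation (K : ℕ) .{{_ : NonZero K}} where

  rotate : ℕ → Fin K → Fin K
  rotate s x = (toℕ x + s) mod K

  toℕ-rotate : ∀ s x → toℕ (rotate s x) ≡ (toℕ x + s) % K
  toℕ-rotate s x = toℕ-fromℕ< (m%n<n (toℕ x + s) K)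

  rotate-rotate : ∀ s t x → rotate t (rotate s x) ≡ rotate (s + t) x
  rotate-rotate s t x = toℕ-injective (begin
    toℕ (rotate t (rotate s x)) ≡⟨ toℕ-rotate t (rotate s x) ⟩
    (toℕ (rotate s x) + t) % K  ≡⟨ cong (λ r → (r + t) % K) (toℕ-rotate s x) ⟩
    ((toℕ x + s) % K + t) % K   ≡⟨ [m%n+o]%n≡[m+o]%n (toℕ x + s) t K ⟩
    (toℕ x + s + t) % K         ≡⟨ cong (_% K) (+-assoc (toℕ x) s t) ⟩
    (toℕ x + (s + t)) % K       ≡⟨ toℕ-rotate (s + t) x ⟨
    toℕ (rotate (s + t) x)      ∎)
    where open ≡-Reasoning

  rotate-0 : ∀ x → rotate 0 x ≡ x
  rotate-0 x = toℕ-injective (begin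
    toℕ (rotate 0 x) ≡⟨ toℕ-rotate 0 x ⟩
    (toℕ x + 0) % K  ≡⟨ cong (_% K) (+-identityʳ (toℕ x)) ⟩
    toℕ x % K        ≡⟨ m<n⇒m%n≡m (toℕ<n x) ⟩
    toℕ x            ∎)
    where open ≡-Reasoning

  rotate-K : ∀ x → rotate K x ≡ x
  rotate-K x = toℕ-injective (begin
    toℕ (rotate K x) ≡⟨ toℕ-rotate K x ⟩
    (toℕ x + K) % K  ≡⟨ [m+n]%n≡m%n (toℕ x) K ⟩
    toℕ x % K        ≡⟨ m<n⇒m%n≡m (toℕ<n x) ⟩
    toℕ x            ∎)
    where open ≡-Reasoning

  rotation : ∀ s → s ≤ K → Permutation′ K
  rotation s s≤K = permutation (rotate s) (rotate (K ∸ s)) rotate-rotate⁻¹ rotate⁻¹-rotate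

    where
    rotate-rotate⁻¹ : ∀ y → rotate s (rotate (K ∸ s) y) ≡ y
    rotate-rotate⁻¹ y = trans (rotate-rotate (K ∸ s) s y)
                               (trans (cong (λ t → rotate t y) (m∸n+n≡m s≤K)) (rotate-K y))
    rotate⁻¹-rotate : ∀ x → rotate (K ∸ s) (rotate s x) ≡ x
    rotate⁻¹-rotate x = trans (rotate-rotate s (K ∸ s) x)
                                (trans (cong (λ t → rotate t x) (m+[n∸m]≡n s≤K)) (rotate-K x))

  rotate-injectiveˡ : ∀ {s t} x → s < K → t < K → rotate s x ≡ rotate t x → s ≡ t
  rotate-injectiveˡ {s} {t} x s<K t<K rs≡rt = begin
    s                                     ≡⟨ toℕ-rotate-back s<K ⟨
    toℕ (rotate (K ∸ toℕ x) (rotate s x)) ≡⟨ cong (toℕ ∘ rotate (K ∸ toℕ x)) rs≡rt ⟩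
    toℕ (rotate (K ∸ toℕ x) (rotate t x)) ≡⟨ toℕ-rotate-back t<K ⟩
    t                                     ∎
    where
    open ≡-Reasoning
    toℕ-rotate-back : ∀ {u} → u < K → toℕ (rotate (K ∸ toℕ x) (rotate u x)) ≡ u
    toℕ-rotate-back {u} u<K = begin
      toℕ (rotate (K ∸ toℕ x) (rotate u x)) ≡⟨ cong toℕ (rotate-rotate u (K ∸ toℕ x) x) ⟩
      toℕ (rotate (u + (K ∸ toℕ x)) x)      ≡⟨ toℕ-rotate (u + (K ∸ toℕ x)) x ⟩
      (toℕ x + (u + (K ∸ toℕ x))) % K       ≡⟨ cong (_% K) (x∙yz≈y∙xz (toℕ x) u (K ∸ toℕ x)) ⟩
      (u + (toℕ x + (K ∸ toℕ x))) % K       ≡⟨ cong ((_% K) ∘ (u +_)) (m+[n∸m]≡n (<⇒≤ (toℕ<n x))) ⟩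
      (u + K) % K                           ≡⟨ [m+n]%n≡m%n u K ⟩
      u % K                                 ≡⟨ m<n⇒m%n≡m u<K ⟩
      u                                     ∎

  rotate-≢ : ∀ {s} x → 0 < s → s < K → rotate s x ≢ x
  rotate-≢ {s} x 0<s s<K rs≡x =
    <⇒≢ 0<s (sym (rotate-injectiveˡ x s<K (≤-trans z<s s<K) (trans rs≡x (sym (rotate-0 x)))))

∑-decode : ∀ G H (f : Fin (size G) ⊎ (Fin (size G) × Fin (size H)) → ℕ) →
  ∑[ x < size (corona G H) ] f (decode G H x)
    ≡ ∑[ u < size G ] f (inj₁ u) + ∑[ u < size G ] ∑[ a < size H ] f (inj₂ (u , a))
∑-decode G H f =
  trans (∑-splitAt (size G) (size G * size H) (f ∘ Sum.map₂ (remQuot (size H))))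
        (cong (∑[ u < size G ] f (inj₁ u) +_) (∑-remQuot (size G) (size H) (f ∘ inj₂)))

classSize≡count : ∀ G k (c : Fin (size G) → Fin k) j → classSize G k c j ≡ count c j
classSize≡count G k c j = length-filter-tabulate (λ v → c v ≟ j) (size G) id

same⇒≡ : ∀ {n} {a b : Fin n} → same a b ≡ true → a ≡ b
same⇒≡ = toWitness ∘ Equivalence.from T-≡

record UniformColouring (k : ℕ) (G : Graph) : Set where
  field
    colour       : Fin (size G) → Fin k
    proper       : Proper G k colour
    classCard    : ℕ
    count-colour : ∀ j → count colour j ≡ classCard

equitable⇒uniform : ∀ {k G} → k ∣ size G → EquitablyColorable k G → UniformColouring k G
equitable⇒uniform {k} {G} (divides q n≡q*k) (c , c-proper , c-equitable) = record
  { colour       = c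
  ; proper       = c-proper
  ; classCard    = q
  ; count-colour = spread≤1-∑≡q*k⇒≡q k (count c) q (trans (∑-count c) n≡q*k) count-bounded
  }
  where
  count-bounded : ∀ i j → count c i ≤ suc (count c j)
  count-bounded i j = subst₂ (λ a b → a ≤ suc b)
    (classSize≡count G k c i) (classSize≡count G k c j) (c-equitable i j)

uniform⇒equitable : ∀ {k G} → UniformColouring k G → EquitablyColorable k G
uniform⇒equitable {k} {G} U = colour , proper , λ i j →
  subst₂ (λ a b → a ≤ suc b)
    (sym (classSize≡classCard i)) (sym (classSize≡classCard j)) (n≤1+n classCard)
  where
  open UniformColouring U
  classSize≡classCard : ∀ j → classSize G k colour j ≡ classCard
  classSize≡classCard j = trans (classSize≡count G k colour j) (count-colour j)

module CoronaColouring {k r : ℕ} (G H : Graph)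
  (hue : Fin (size H) → Fin r) (hue-proper : Proper H r hue) (r<k : r < k)
  (U : UniformColouring k G) where

  open UniformColouring U

  private instance
    k-nonZero : NonZero k
    k-nonZero = >-nonZero (≤-trans z<s r<k)

  open Rotation k

  shift : Fin (size H) → ℕ
  shift a = suc (toℕ (hue a))

  shift<k : ∀ a → shift a < k
  shift<k a = ≤-trans (s≤s (toℕ<n (hue a))) r<k

  coronaColour : Fin (size G) ⊎ (Fin (size G) × Fin (size H)) → Fin k
  coronaColour (inj₁ u)       = colour u
  coronaColour (inj₂ (u , a)) = rotate (shift a) (colour u)

  coronaColour-proper : ∀ x y → cAdj G H x y ≡ true → coronaColour x ≢ coronaColour y
  coronaColour-proper (inj₁ u) (inj₁ v) uv = proper u v uv
  coronaColour-proper (inj₁ u) (inj₂ (i , a)) u≡i c≡c =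
    rotate-≢ (colour i) z<s (shift<k a) (trans (sym c≡c) (cong colour (same⇒≡ u≡i)))
  coronaColour-proper (inj₂ (i , a)) (inj₁ v) i≡v c≡c =
    rotate-≢ (colour i) z<s (shift<k a) (trans c≡c (cong colour (sym (same⇒≡ i≡v))))
  coronaColour-proper (inj₂ (i , a)) (inj₂ (i′ , b)) e c≡c =
    hue-proper a b (Equivalence.to T-≡ (proj₂ same×ab)) (toℕ-injective (suc-injective
      (rotate-injectiveˡ (colour i) (shift<k a) (shift<k b)
        (trans c≡c (cong (rotate (shift b) ∘ colour) (sym (toWitness (proj₁ same×ab))))))))
    where same×ab = Equivalence.to T-∧ (Equivalence.from T-≡ e)

  count-coronaColour : ∀ j →
    count (coronaColour ∘ decode G H) j ≡ classCard + size H * classCard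
  count-coronaColour j = begin
    count (coronaColour ∘ decode G H) j
      ≡⟨ ∑-decode G H (λ x → indicator (coronaColour x ≟ j)) ⟩
    count colour j + ∑[ u < size G ] ∑[ a < size H ] indicator (rotate (shift a) (colour u) ≟ j)
      ≡⟨ cong₂ _+_ (count-colour j) (∑-comm λ u a → indicator (rotate (shift a) (colour u) ≟ j)) ⟩
    classCard + ∑[ a < size H ] count (rotate (shift a) ∘ colour) j
      ≡⟨ cong (classCard +_) (sum-cong-≗ λ a →
           trans (count-permute (rotation (shift a) (<⇒≤ (shift<k a))) colour j) (count-colour _)) ⟩
    classCard + ∑[ a < size H ] classCard
      ≡⟨ cong (classCard +_) (∑-const (size H) classCard) ⟩
    classCard + size H * classCard
      ∎
    where open ≡-Reasoning

corona-uniform : ∀ {k r G H} → Partite r H → r < k →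
  UniformColouring k G → UniformColouring k (corona G H)
corona-uniform {G = G} {H} (hue , hue-proper) r<k U = record
  { colour       = coronaColour ∘ decode G H
  ; proper       = λ x y → coronaColour-proper (decode G H x) (decode G H y)
  ; classCard    = _
  ; count-colour = count-coronaColour
  }
  where open CoronaColouring G H hue hue-proper r<k U

coronaIter-uniform : ∀ {k r G H} → Partite r H → r < k → UniformColouring k G →
  ∀ l → UniformColouring k (coronaIter G H l)
coronaIter-uniform H-partite r<k U zero    = corona-uniform H-partite r<k U
coronaIter-uniform H-partite r<k U (suc l) =
  corona-uniform H-partite r<k (coronaIter-uniform H-partite r<k U l)

corollary1 : (G H : Graph) (k r : ℕ) →
    Connected G → Connected H →
    EquitablyColorable k G → Partite r H → r + 1 ≤ k →
    k ∣ size G →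
    (l : ℕ) (1≤l : 1 ≤ l) → EqChromaticAtMost (corona^ G H l 1≤l) k
corollary1 G H k r _ _ G-equitable H-partite r+1≤k k∣n (suc l) _ =
  k , ≤-refl , uniform⇒equitable
    (coronaIter-uniform H-partite r<k (equitable⇒uniform k∣n G-equitable) l)
  where
  r<k : r < k
  r<k = subst (_≤ k) (+-comm r 1) r+1≤k
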